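{- For all types $\sigma,\tau,\rho$ the following isomorphisms hold: $\sigma\wedge\sigma\approx\sigma$, $\sigma\vee\sigma\approx\sigma$; $\sigma\wedge\tau\approx\tau\wedge\sigma$, $\sigma\vee\tau\approx\tau\vee\sigma$; $(\sigma\wedge\tau)\wedge\rho\approx\sigma\wedge(\tau\wedge\rho)$, $(\sigma\vee\tau)\vee\rho\approx\sigma\vee(\tau\vee\rho)$; $\sigma\to\tau\wedge\rho\approx(\sigma\to\tau)\wedge(\sigma\to\rho)$; $\sigma\vee\tau\to\rho\approx(\sigma\to\rho)\wedge(\tau\to\rho)$; $\sigma\to\tau\to\rho\approx\tau\to\sigma\to\rho$; $(\sigma\vee\tau)\wedge\rho\approx(\sigma\wedge\rho)\vee(\tau\wedge\rho)$; $(\sigma\wedge\tau)\vee\rho\approx(\sigma\vee\rho)\wedge(\tau\vee\rho)$.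
   Context: Types: $\sigma ::= \varphi \mid \sigma\to\sigma \mid \sigma\wedge\sigma \mid \sigma\vee\sigma$ ($\varphi$ atomic; $\wedge,\vee$ bind tighter than $\to$, $\to$ associates to the right); no equivalence between types is assumed. Typing of linear $\lambda$-terms (each variable occurs exactly once): (Ax) $x:\sigma\vdash x:\sigma$; ($\to$I) from $\Gamma,x:\sigma\vdash M:\tau$ infer $\Gamma\vdash\lambda x.M:\sigma\to\tau$; ($\to$E) from $\Gamma_1\vdash M:\sigma\to\tau$, $\Gamma_2\vdash N:\sigma$ infer $\Gamma_1,\Gamma_2\vdash MN:\tau$; ($\wedge$I) from $\Gamma\vdash M:\sigma$, $\Gamma\vdash M:\tau$ infer $\Gamma\vdash M:\sigma\wedge\tau$; ($\wedge$E) from $\Gamma\vdash M:\sigma\wedge\tau$ infer $\Gamma\vdash M:\sigma$ and $\Gamma\vdash M:\tau$; ($\vee$I) from $\Gamma\vdash M:\sigma$ infer $\Gamma\vdash M:\sigma\vee\tau$ and $\Gamma\vdash M:\tau\vee\sigma$; ($\vee$E) from $\Gamma_1,x:\sigma\wedge\theta\vdash M:\rho$, $\Gamma_1,x:\tau\wedge\theta\vdash M:\rho$, $\Gamma_2\vdash N:(\sigma\vee\tau)\wedge\theta$ infer $\Gamma_1,\Gamma_2\vdash M[N/x]:\rho$ (environments: finite sets of $x:\sigma$, distinct variables; $\Gamma_1,\Gamma_2$ disjoint). A finite hereditary permutator (FHP) is a $\lambda$-term which modulo $\beta$-conversion has the form $\lambda xy_1\dots y_n.x(P_1y_{\pi(1)})\dots(P_ny_{\pi(n)})$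 ($n\ge0$), $\pi$ a permutation of $1,\dots,n$, $P_i$ FHPs. Two types are isomorphic, $\sigma\approx\tau$, if there are FHPs $P,P'$ inverse of each other (i.e. $\lambda x.P(P'x)$ and $\lambda x.P'(Px)$ are $\beta\eta$-equal to $\lambda x.x$) such that $\vdash P:\sigma\to\tau$ and $\vdash P':\tau\to\sigma$. -}

module Defs where

open import Data.Nat using (ℕ; zero; suc)
open import Data.Fin using (Fin; zero; suc; fromℕ; inject₁; opposite)
open import Data.Fin.Permutation using (Permutation′; _⟨$⟩ʳ_)
open import Data.Maybe using (Maybe; just; nothing)
open import Data.Vec using (Vec; []; _∷_; replicate)
open import Data.Product using (Σ; _×_; _,_)
open import Relation.Binary.PropositionalEquality using (_≡_)

infixr 5 _⇒_
infixr 6 _∧_ _∨_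

data Ty : Set where
  atom : ℕ → Ty
  _⇒_  : Ty → Ty → Ty
  _∧_  : Ty → Ty → Ty
  _∨_  : Ty → Ty → Ty

infixl 7 _·_
infix 8 _[_]
infix 4 _→β_ _→βη_ _=β_ _=βη_

data Term (n : ℕ) : Set where
  var : Fin n → Term n
  ƛ   : Term (suc n) → Term n
  _·_ : Term n → Term n → Term n

ext : ∀ {m n} → (Fin m → Fin n) → Fin (suc m) → Fin (suc n)
ext ρ zero    = zero
ext ρ (suc i) = suc (ρ i)

rename : ∀ {m n} → (Fin m → Fin n) → Term m → Term n
rename ρ (var i) = var (ρ i)
rename ρ (ƛ M)   = ƛ (rename (ext ρ) M)
rename ρ (M · N) = rename ρ M · rename ρ N

exts : ∀ {m n} → (Fin m → Term n) → Fin (suc m) → Term (suc n)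
exts s zero    = var zero
exts s (suc i) = rename suc (s i)

subst : ∀ {m n} → (Fin m → Term n) → Term m → Term n
subst s (var i) = s i
subst s (ƛ M)   = ƛ (subst (exts s) M)
subst s (M · N) = subst s M · subst s N

subst₀ : ∀ {n} → Term n → Fin (suc n) → Term n
subst₀ N zero    = N
subst₀ N (suc i) = var i

_[_] : ∀ {n} → Term (suc n) → Term n → Term n
M [ N ] = subst (subst₀ N) M

wk : ∀ {n} → Term 0 → Term n
wk = rename (λ ())

data _→β_ {n : ℕ} : Term n → Term n → Set where
  β    : ∀ {M N} → (ƛ M) · N →β M [ N ]
  ξƛ   : ∀ {M M'} → M →β M' → ƛ M →β ƛ M'
  ξ·₁  : ∀ {M M' N} → M →β M' → M · N →β M' · N
  ξ·₂  : ∀ {M N N'} → N →β N' → M · N →β M · N'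

data _→βη_ {n : ℕ} : Term n → Term n → Set where
  β    : ∀ {M N} → (ƛ M) · N →βη M [ N ]
  η    : ∀ {M} → ƛ (rename suc M · var zero) →βη M
  ξƛ   : ∀ {M M'} → M →βη M' → ƛ M →βη ƛ M'
  ξ·₁  : ∀ {M M' N} → M →βη M' → M · N →βη M' · N
  ξ·₂  : ∀ {M N N'} → N →βη N' → M · N →βη M · N'

data _=β_ {n : ℕ} : Term n → Term n → Set where
  step  : ∀ {M N} → M →β N → M =β N
  refl  : ∀ {M} → M =β M
  sym   : ∀ {M N} → M =β N → N =β M
  trans : ∀ {L M N} → L =β M → M =β N → L =β N

data _=βη_ {n : ℕ} : Term n → Term n → Set where
  step  : ∀ {M N} → M →βη N → M =βη N
  refl  : ∀ {M} → M =βη M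
  sym   : ∀ {M N} → M =βη N → N =βη M
  trans : ∀ {L M N} → L =βη M → M =βη N → L =βη N

-- Environments: for scope n, a vector telling which variables are
-- declared and with which type (nothing = not in the environment).

Env : ℕ → Set
Env n = Vec (Maybe Ty) n

only : ∀ {n} → Fin n → Ty → Env n
only {suc n} zero    σ = just σ ∷ replicate n nothing
only {suc n} (suc i) σ = nothing ∷ only i σ

-- Split Γ Γ₁ Γ₂ : Γ = Γ₁ , Γ₂ with Γ₁ and Γ₂ disjoint
data Split : ∀ {n} → Env n → Env n → Env n → Set where
  []  : Split [] [] []
  non : ∀ {n} {Γ Γ₁ Γ₂ : Env n} → Split Γ Γ₁ Γ₂ →
        Split (nothing ∷ Γ) (nothing ∷ Γ₁) (nothing ∷ Γ₂)
  lft : ∀ {n σ} {Γ Γ₁ Γ₂ : Env n} → Split Γ Γ₁ Γ₂ →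
        Split (just σ ∷ Γ) (just σ ∷ Γ₁) (nothing ∷ Γ₂)
  rgt : ∀ {n σ} {Γ Γ₁ Γ₂ : Env n} → Split Γ Γ₁ Γ₂ →
        Split (just σ ∷ Γ) (nothing ∷ Γ₁) (just σ ∷ Γ₂)

infix 4 _⊢_∶_

data _⊢_∶_ {n : ℕ} : Env n → Term n → Ty → Set where
  Ax  : ∀ {x σ} → only x σ ⊢ var x ∶ σ
  ⇒I  : ∀ {Γ M σ τ} → (just σ ∷ Γ) ⊢ M ∶ τ → Γ ⊢ ƛ M ∶ σ ⇒ τ
  ⇒E  : ∀ {Γ Γ₁ Γ₂ M N σ τ} → Split Γ Γ₁ Γ₂ →
        Γ₁ ⊢ M ∶ σ ⇒ τ → Γ₂ ⊢ N ∶ σ → Γ ⊢ M · N ∶ τ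
  ∧I  : ∀ {Γ M σ τ} → Γ ⊢ M ∶ σ → Γ ⊢ M ∶ τ → Γ ⊢ M ∶ σ ∧ τ
  ∧E₁ : ∀ {Γ M σ τ} → Γ ⊢ M ∶ σ ∧ τ → Γ ⊢ M ∶ σ
  ∧E₂ : ∀ {Γ M σ τ} → Γ ⊢ M ∶ σ ∧ τ → Γ ⊢ M ∶ τ
  ∨I₁ : ∀ {Γ M σ τ} → Γ ⊢ M ∶ σ → Γ ⊢ M ∶ σ ∨ τ
  ∨I₂ : ∀ {Γ M σ τ} → Γ ⊢ M ∶ σ → Γ ⊢ M ∶ τ ∨ σ
  ∨E  : ∀ {Γ Γ₁ Γ₂ L σ τ θ ρ} {M : Term (suc n)} {N : Term n} →
        Split Γ Γ₁ Γ₂ →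
        (just (σ ∧ θ) ∷ Γ₁) ⊢ M ∶ ρ →
        (just (τ ∧ θ) ∷ Γ₁) ⊢ M ∶ ρ →
        Γ₂ ⊢ N ∶ (σ ∨ τ) ∧ θ →
        L ≡ M [ N ] →
        Γ ⊢ L ∶ ρ

lams : ∀ k → Term k → Term 0
lams zero    M = M
lams (suc k) M = lams k (ƛ M)

spine : ∀ {m} k → Term m → (Fin k → Term m) → Term m
spine zero    h a = h
spine (suc k) h a = spine k (h · a zero) (λ i → a (suc i))

-- λ x y₁ … yₙ . x (Q₁ y_{π(1)}) … (Qₙ y_{π(n)})
-- In scope suc n: x has index n (fromℕ n), y_{j+1} (j : Fin n) has
-- index n-1-j (inject₁ (opposite j)).
fhpForm : ∀ n → Permutation′ n → (Fin n → Term 0) → Term 0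
fhpForm n π Q =
  lams (suc n)
    (spine n (var (fromℕ n))
       (λ i → wk (Q i) · var (inject₁ (opposite (π ⟨$⟩ʳ i)))))

data FHP : Term 0 → Set where
  fhp : ∀ {P} (n : ℕ) (π : Permutation′ n) (Q : Fin n → Term 0) →
        (∀ i → FHP (Q i)) → P =β fhpForm n π Q → FHP P

compose : Term 0 → Term 0 → Term 0
compose P P' = ƛ (wk P · (wk P' · var zero))

idTerm : Term 0
idTerm = ƛ (var zero)

infix 3 _≈_

_≈_ : Ty → Ty → Set
σ ≈ τ = Σ (Term 0) λ P → Σ (Term 0) λ P' →
  FHP P × FHP P' ×
  ([] ⊢ P ∶ σ ⇒ τ) × ([] ⊢ P' ∶ τ ⇒ σ) ×
  (compose P P' =βη idTerm) × (compose P' P =βη idTerm)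

-- Union and intersection are proof-irrelevant in this system: (∧I), (∨I) and
-- (∨E) with both the eliminated term and the body equal to x never change the
-- subject. So every isomorphism not involving ⇒ is witnessed by λx.x typed in
-- both directions. The three arrow isomorphisms are witnessed by λxy.xy and
-- λxyz.xzy. All three witnesses are FHPs and self-inverse modulo βη.
module Submission where

open import Defs
open import Data.Product using (_×_; _,_)
open import Data.Fin using (Fin; zero; suc)
open import Data.Maybe using (just; nothing)
open import Data.Vec using ([]; _∷_)
open import Relation.Binary.PropositionalEquality using (refl)
import Data.Fin.Permutation as Perm

infixr 2 _▸_

_▸_ : ∀ {n} {L M N : Term n} → L →βη M → M =βη N → L =βη N
r ▸ M=N = trans (step r) M=N

etaIdTerm flipTerm : Term 0
etaIdTerm = ƛ (ƛ (var (suc zero) · var zero))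
flipTerm  = ƛ (ƛ (ƛ (var (suc (suc zero)) · var zero · var (suc zero))))

idTerm-FHP : FHP idTerm
idTerm-FHP = fhp 0 Perm.id (λ ()) (λ ()) refl

etaIdTerm-FHP : FHP etaIdTerm
etaIdTerm-FHP = fhp 1 Perm.id (λ _ → idTerm) (λ _ → idTerm-FHP)
  (sym (step (ξƛ (ξƛ (ξ·₂ β)))))

flipTerm-FHP : FHP flipTerm
flipTerm-FHP = fhp 2 (Perm.transpose zero (suc zero)) (λ _ → idTerm) (λ _ → idTerm-FHP)
  (sym (trans (step (ξƛ (ξƛ (ξƛ (ξ·₁ (ξ·₂ β))))))
              (step (ξƛ (ξƛ (ξƛ (ξ·₂ β)))))))

idTerm-involutive : compose idTerm idTerm =βη idTerm
idTerm-involutive = ξƛ (ξ·₂ β) ▸ ξƛ β ▸ refl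

etaIdTerm-involutive : compose etaIdTerm etaIdTerm =βη idTerm
etaIdTerm-involutive =
  ξƛ (ξ·₂ β) ▸ ξƛ β ▸ ξƛ (ξƛ β) ▸ ξƛ (η {M = var zero}) ▸ refl

flipTerm-involutive : compose flipTerm flipTerm =βη idTerm
flipTerm-involutive =
  ξƛ (ξ·₂ β) ▸ ξƛ β ▸ ξƛ (ξƛ (ξƛ (ξ·₁ β))) ▸ ξƛ (ξƛ (ξƛ β)) ▸
  ξƛ (ξƛ (η {M = var (suc zero) · var zero})) ▸ ξƛ (η {M = var zero}) ▸ refl

≈-bySelfInverse : ∀ {P σ τ} → FHP P → compose P P =βη idTerm →
                  [] ⊢ P ∶ σ ⇒ τ → [] ⊢ P ∶ τ ⇒ σ → σ ≈ τ
≈-bySelfInverse {P} fhpP PP=id ⊢σ⇒τ ⊢τ⇒σ =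
  P , P , fhpP , fhpP , ⊢σ⇒τ , ⊢τ⇒σ , PP=id , PP=id

≈-byIdentity : ∀ {σ τ} → just σ ∷ [] ⊢ var zero ∶ τ → just τ ∷ [] ⊢ var zero ∶ σ → σ ≈ τ
≈-byIdentity x⊢τ x⊢σ = ≈-bySelfInverse idTerm-FHP idTerm-involutive (⇒I x⊢τ) (⇒I x⊢σ)

∨E-var : ∀ {n σ τ θ ρ} {x : Fin n} {Γ Γ₁ Γ₂ : Env n} → Split Γ Γ₁ Γ₂ →
         just (σ ∧ θ) ∷ Γ₁ ⊢ var zero ∶ ρ →
         just (τ ∧ θ) ∷ Γ₁ ⊢ var zero ∶ ρ →
         Γ₂ ⊢ var x ∶ (σ ∨ τ) ∧ θ →
         Γ ⊢ var x ∶ ρ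
∨E-var split left right scrutinee = ∨E split left right scrutinee refl

∧-idem : ∀ σ → σ ∧ σ ≈ σ
∧-idem σ = ≈-byIdentity (∧E₁ Ax) (∧I Ax Ax)

∨-idem : ∀ σ → σ ∨ σ ≈ σ
∨-idem σ = ≈-byIdentity (∨E-var {θ = σ ∨ σ} (rgt []) (∧E₁ Ax) (∧E₁ Ax) (∧I Ax Ax)) (∨I₁ Ax)

∧-comm : ∀ σ τ → σ ∧ τ ≈ τ ∧ σ
∧-comm σ τ = ≈-byIdentity (∧I (∧E₂ Ax) (∧E₁ Ax)) (∧I (∧E₂ Ax) (∧E₁ Ax))

∨-comm : ∀ σ τ → σ ∨ τ ≈ τ ∨ σ
∨-comm σ τ = ≈-byIdentity
  (∨E-var {θ = σ ∨ τ} (rgt []) (∨I₂ (∧E₁ Ax)) (∨I₁ (∧E₁ Ax)) (∧I Ax Ax))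
  (∨E-var {θ = τ ∨ σ} (rgt []) (∨I₂ (∧E₁ Ax)) (∨I₁ (∧E₁ Ax)) (∧I Ax Ax))

∧-assoc : ∀ σ τ ρ → (σ ∧ τ) ∧ ρ ≈ σ ∧ (τ ∧ ρ)
∧-assoc σ τ ρ = ≈-byIdentity
  (∧I (∧E₁ (∧E₁ Ax)) (∧I (∧E₂ (∧E₁ Ax)) (∧E₂ Ax)))
  (∧I (∧I (∧E₁ Ax) (∧E₁ (∧E₂ Ax))) (∧E₂ (∧E₂ Ax)))

∨-assoc : ∀ σ τ ρ → (σ ∨ τ) ∨ ρ ≈ σ ∨ (τ ∨ ρ)
∨-assoc σ τ ρ = ≈-byIdentity
  (∨E-var {θ = (σ ∨ τ) ∨ ρ} (rgt [])
    (∨E-var {θ = (σ ∨ τ) ∧ ((σ ∨ τ) ∨ ρ)} (rgt (non []))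
      (∨I₁ (∧E₁ Ax)) (∨I₂ (∨I₁ (∧E₁ Ax))) (∧I (∧E₁ Ax) Ax))
    (∨I₂ (∨I₂ (∧E₁ Ax)))
    (∧I Ax Ax))
  (∨E-var {θ = σ ∨ (τ ∨ ρ)} (rgt [])
    (∨I₁ (∨I₁ (∧E₁ Ax)))
    (∨E-var {θ = (τ ∨ ρ) ∧ (σ ∨ (τ ∨ ρ))} (rgt (non []))
      (∨I₁ (∨I₂ (∧E₁ Ax))) (∨I₂ (∧E₁ Ax)) (∧I (∧E₁ Ax) Ax))
    (∧I Ax Ax))

⇒-distribˡ-∧ : ∀ σ τ ρ → σ ⇒ τ ∧ ρ ≈ (σ ⇒ τ) ∧ (σ ⇒ ρ)
⇒-distribˡ-∧ σ τ ρ = ≈-bySelfInverse etaIdTerm-FHP etaIdTerm-involutive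
  (⇒I (∧I (⇒I (∧E₁ (⇒E (rgt (lft [])) Ax Ax)))
          (⇒I (∧E₂ (⇒E (rgt (lft [])) Ax Ax)))))
  (⇒I (⇒I (∧I (⇒E (rgt (lft [])) (∧E₁ Ax) Ax)
              (⇒E (rgt (lft [])) (∧E₂ Ax) Ax))))

∨-⇒-distrib : ∀ σ τ ρ → σ ∨ τ ⇒ ρ ≈ (σ ⇒ ρ) ∧ (τ ⇒ ρ)
∨-⇒-distrib σ τ ρ = ≈-bySelfInverse etaIdTerm-FHP etaIdTerm-involutive
  (⇒I (∧I (⇒I (⇒E (rgt (lft [])) Ax (∨I₁ Ax)))
          (⇒I (⇒E (rgt (lft [])) Ax (∨I₂ Ax)))))
  (⇒I (⇒I (∨E {θ = σ ∨ τ} {M = var (suc (suc zero)) · var zero} (rgt (lft []))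
    (⇒E (rgt (non (lft []))) (∧E₁ Ax) (∧E₁ Ax))
    (⇒E (rgt (non (lft []))) (∧E₂ Ax) (∧E₁ Ax))
    (∧I Ax Ax) refl)))

⇒-exchange : ∀ σ τ ρ → σ ⇒ τ ⇒ ρ ≈ τ ⇒ σ ⇒ ρ
⇒-exchange σ τ ρ = ≈-bySelfInverse flipTerm-FHP flipTerm-involutive flip⊢ flip⊢
  where
  flip⊢ : ∀ {α β} → [] ⊢ flipTerm ∶ (α ⇒ β ⇒ ρ) ⇒ β ⇒ α ⇒ ρ
  flip⊢ = ⇒I (⇒I (⇒I (⇒E (lft (rgt (lft []))) (⇒E (rgt (non (lft []))) Ax Ax) Ax)))

∧-distribʳ-∨ : ∀ σ τ ρ → (σ ∨ τ) ∧ ρ ≈ (σ ∧ ρ) ∨ (τ ∧ ρ)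
∧-distribʳ-∨ σ τ ρ = ≈-byIdentity
  (∨E-var {θ = ρ} (rgt []) (∨I₁ Ax) (∨I₂ Ax) Ax)
  (∨E-var {θ = (σ ∧ ρ) ∨ (τ ∧ ρ)} (rgt [])
    (∧I (∨I₁ (∧E₁ (∧E₁ Ax))) (∧E₂ (∧E₁ Ax)))
    (∧I (∨I₂ (∧E₁ (∧E₁ Ax))) (∧E₂ (∧E₁ Ax)))
    (∧I Ax Ax))

∨-distribʳ-∧ : ∀ σ τ ρ → (σ ∧ τ) ∨ ρ ≈ (σ ∨ ρ) ∧ (τ ∨ ρ)
∨-distribʳ-∧ σ τ ρ = ≈-byIdentity
  (∨E-var {θ = (σ ∧ τ) ∨ ρ} (rgt [])
    (∧I (∨I₁ (∧E₁ (∧E₁ Ax))) (∨I₁ (∧E₂ (∧E₁ Ax))))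
    (∧I (∨I₂ (∧E₁ Ax)) (∨I₂ (∧E₁ Ax)))
    (∧I Ax Ax))
  (∨E-var {θ = τ ∨ ρ} (rgt [])
    (∨E-var {θ = σ} (rgt (non []))
      (∨I₁ (∧I (∧E₂ Ax) (∧E₁ Ax))) (∨I₂ (∧E₁ Ax)) (∧I (∧E₂ Ax) (∧E₁ Ax)))
    (∨I₂ (∧E₁ Ax))
    Ax)

mainTheorem10 : ∀ σ τ ρ →
    (σ ∧ σ ≈ σ) × (σ ∨ σ ≈ σ) ×
    (σ ∧ τ ≈ τ ∧ σ) × (σ ∨ τ ≈ τ ∨ σ) ×
    ((σ ∧ τ) ∧ ρ ≈ σ ∧ (τ ∧ ρ)) × ((σ ∨ τ) ∨ ρ ≈ σ ∨ (τ ∨ ρ)) ×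
    (σ ⇒ τ ∧ ρ ≈ (σ ⇒ τ) ∧ (σ ⇒ ρ)) ×
    (σ ∨ τ ⇒ ρ ≈ (σ ⇒ ρ) ∧ (τ ⇒ ρ)) ×
    (σ ⇒ τ ⇒ ρ ≈ τ ⇒ σ ⇒ ρ) ×
    ((σ ∨ τ) ∧ ρ ≈ (σ ∧ ρ) ∨ (τ ∧ ρ)) ×
    ((σ ∧ τ) ∨ ρ ≈ (σ ∨ ρ) ∧ (τ ∨ ρ))
mainTheorem10 σ τ ρ =
  ∧-idem σ , ∨-idem σ , ∧-comm σ τ , ∨-comm σ τ ,
  ∧-assoc σ τ ρ , ∨-assoc σ τ ρ , ⇒-distribˡ-∧ σ τ ρ , ∨-⇒-distrib σ τ ρ ,
  ⇒-exchange σ τ ρ , ∧-distribʳ-∨ σ τ ρ , ∨-distribʳ-∧ σ τ ρ
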